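{- Let $b,c$ be positive integers and $(a_1,a_2)\in\mathbb{Z}_{>0}^2$. Then $(a_1,a_2)$ is a positive imaginary root if and only if $a_1p+a_2q\le a_1a_2$ for every $(p,q)\in P$, i.e. if and only if $P$ is contained in the triangle with vertices $(0,0)$, $(a_2,0)$, $(0,a_1)$.
   Context: With $Q(a_1,a_2)=ca_1^2-bca_1a_2+ba_2^2$, a positive imaginary root is $(a_1,a_2)\in\mathbb{Z}_{>0}^2$ with $Q(a_1,a_2)\le0$. $P=P[a_1,a_2]\subset\mathbb{R}^2$ is the region bounded by the broken line $(0,0),(a_2,0),(a_1/b,a_2/c),(0,a_1),(0,0)$, including the sides $[(0,0),(a_2,0)]$ and $[(0,a_1),(0,0)]$ but excluding the rest of the boundary.
   Formalization: The points $(p,q)$ of the region $P$ are taken only with rational coordinates rather than ranging over all of ℝ². -}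

module Defs where

open import Data.Nat as ℕ using (ℕ; NonZero)
open import Data.Integer as ℤ using (ℤ; +_)
open import Data.Rational as ℚ using (ℚ; 0ℚ; 1ℚ; _/_)
open import Data.Product using (_×_; ∃₂; _,_)
open import Data.Sum using (_⊎_)
open import Relation.Binary.PropositionalEquality using (_≡_)

Q : (b c a₁ a₂ : ℕ) → ℤ
Q b c a₁ a₂ =
  (+ c ℤ.* + a₁ ℤ.* + a₁) ℤ.- (+ b ℤ.* + c ℤ.* + a₁ ℤ.* + a₂) ℤ.+ (+ b ℤ.* + a₂ ℤ.* + a₂)

PosImagRoot : (b c a₁ a₂ : ℕ) → Set
PosImagRoot b c a₁ a₂ = (0 ℕ.< a₁) × (0 ℕ.< a₂) × (Q b c a₁ a₂ ℤ.≤ ℤ.0ℤ)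

Point : Set
Point = ℚ × ℚ

ℕ→ℚ : ℕ → ℚ
ℕ→ℚ n = + n / 1

comb : ℚ → Point → ℚ → Point → Point
comb s (x₁ , y₁) t (x₂ , y₂) = (s ℚ.* x₁ ℚ.+ t ℚ.* x₂ , s ℚ.* y₁ ℚ.+ t ℚ.* y₂)

-- Membership in P = P[a₁,a₂]: the region bounded by the broken line
-- O=(0,0), A=(a₂,0), V=(a₁/b,a₂/c), B=(0,a₁), O, containing the closed
-- sides [O,A] and [B,O] but no other boundary point.  Since V lies in the
-- open positive quadrant, the diagonal OV lies inside the quadrilateral,
-- and P is the union of the triangles OAV and OVB with the sides (A,V]
-- and [V,B) removed.
module _ (b c a₁ a₂ : ℕ) .{{_ : NonZero b}} .{{_ : NonZero c}} where

  vO vA vV vB : Point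
  vO = (0ℚ , 0ℚ)
  vA = (ℕ→ℚ a₂ , 0ℚ)
  vV = (+ a₁ / b , + a₂ / c)
  vB = (0ℚ , ℕ→ℚ a₁)

  InOAV : Point → Set
  InOAV x = ∃₂ λ s t → (0ℚ ℚ.≤ s) × (0ℚ ℚ.≤ t)
              × ((s ℚ.+ t ℚ.< 1ℚ) ⊎ ((t ≡ 0ℚ) × (s ℚ.≤ 1ℚ)))
              × (x ≡ comb s vA t vV)

  InOVB : Point → Set
  InOVB x = ∃₂ λ s t → (0ℚ ℚ.≤ s) × (0ℚ ℚ.≤ t)
              × ((s ℚ.+ t ℚ.< 1ℚ) ⊎ ((s ≡ 0ℚ) × (t ℚ.≤ 1ℚ)))
              × (x ≡ comb s vV t vB)

  InP : Point → Set
  InP x = InOAV x ⊎ InOVB x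

-- The linear form ℓ(p,q) = a₁p + a₂q takes the value a₁a₂ at A and B, and
-- bc·(ℓ(V) − a₁a₂) = Q(a₁,a₂). Every point of P is a convex combination of
-- two of the vertices A, V, B (with weights summing to at most 1), so ℓ ≤ a₁a₂
-- on P as soon as ℓ(V) ≤ a₁a₂. Conversely P contains tV for every 0 ≤ t < 1,
-- and ℓ(tV) = t·ℓ(V) exceeds a₁a₂ for t close to 1 when ℓ(V) > a₁a₂.
module Submission where

open import Defs
open import Data.Nat using (ℕ; NonZero; _<_)
open import Data.Rational using (ℚ; _≤_; _+_; _*_)
open import Data.Product using (_,_)
open import Function.Bundles using (_⇔_)

open import Data.Nat as ℕ using (suc)
import Data.Nat.Properties as ℕP
open import Data.Integer as ℤ using (ℤ; +_; 0ℤ)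
import Data.Integer.Properties as ℤP
open import Data.Integer.Tactic.RingSolver using (solve-∀)
open import Data.Rational as ℚ using (0ℚ; 1ℚ; 1/_; toℚᵘ; fromℚᵘ)
import Data.Rational.Properties as ℚP
open import Data.Rational.Solver using (module +-*-Solver)
open import Data.Rational.Unnormalised as ℚᵘ using (ℚᵘ; ↥_; ↧_)
import Data.Rational.Unnormalised.Properties as ℚᵘP
open import Data.Product using (_×_; ∃-syntax)
open import Data.Sum using (_⊎_; inj₁; inj₂)
open import Relation.Nullary using (¬_)
open import Relation.Binary.PropositionalEquality
open import Function.Bundles using (mk⇔; Equivalence)
open import Function.Properties.Equivalence using () renaming (trans to ⇔-trans)

linear : ℚ → ℚ → Point → ℚ
linear α β (p , q) = α * p + β * q

linear-comb : ∀ α β s x t y →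
  linear α β (comb s x t y) ≡ s * linear α β x + t * linear α β y
linear-comb α β s (x₁ , y₁) t (x₂ , y₂) =
  solve 8 (λ α β s t x₁ y₁ x₂ y₂ →
             α :* (s :* x₁ :+ t :* x₂) :+ β :* (s :* y₁ :+ t :* y₂)
          := s :* (α :* x₁ :+ β :* y₁) :+ t :* (α :* x₂ :+ β :* y₂))
        refl α β s t x₁ y₁ x₂ y₂
  where open +-*-Solver

convex-≤ : ∀ {s t x y M} → 0ℚ ≤ s → 0ℚ ≤ t → s + t ≤ 1ℚ →
  x ≤ M → y ≤ M → 0ℚ ≤ M → s * x + t * y ≤ M
convex-≤ {s} {t} {x} {y} {M} 0≤s 0≤t s+t≤1 x≤M y≤M 0≤M = begin
  s * x + t * y  ≤⟨ ℚP.+-mono-≤ (ℚP.*-monoˡ-≤-nonNeg s {{ℚ.nonNegative 0≤s}} x≤M)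
                                (ℚP.*-monoˡ-≤-nonNeg t {{ℚ.nonNegative 0≤t}} y≤M) ⟩
  s * M + t * M  ≡⟨ ℚP.*-distribʳ-+ M s t ⟨
  (s + t) * M    ≤⟨ ℚP.*-monoʳ-≤-nonNeg M {{ℚ.nonNegative 0≤M}} s+t≤1 ⟩
  1ℚ * M         ≡⟨ ℚP.*-identityˡ M ⟩
  M              ∎
  where open ℚP.≤-Reasoning

-- Take r strictly between M and W and t = r / W.
scale-above : ∀ {M W} → 0ℚ ≤ M → M ℚ.< W → ∃[ t ] (0ℚ ≤ t × t ℚ.< 1ℚ × M ℚ.< t * W)
scale-above {M} {W} 0≤M M<W with ℚP.<-dense M<W
... | r , M<r , r<W = r * 1/ W , 0≤t , t<1 , subst (M ℚ.<_) (sym tW≡r) M<r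
  where
  instance
    W-pos : ℚ.Positive W
    W-pos = ℚ.positive (ℚP.≤-<-trans 0≤M M<W)
    W-nonZero : ℚ.NonZero W
    W-nonZero = ℚP.pos⇒nonZero W
    r-nonNeg : ℚ.NonNegative r
    r-nonNeg = ℚ.nonNegative (ℚP.<⇒≤ (ℚP.≤-<-trans 0≤M M<r))
    1/W-nonNeg : ℚ.NonNegative (1/ W)
    1/W-nonNeg = ℚP.pos⇒nonNeg (1/ W) {{ℚP.1/pos⇒pos W}}
  0≤t : 0ℚ ≤ r * 1/ W
  0≤t = ℚP.nonNegative⁻¹ _ {{ℚP.nonNeg*nonNeg⇒nonNeg r (1/ W)}}
  t<1 : r * 1/ W ℚ.< 1ℚ
  t<1 = subst (r * 1/ W ℚ.<_) (ℚP.*-inverseʳ W)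
              (ℚP.*-monoˡ-<-pos (1/ W) {{ℚP.1/pos⇒pos W}} r<W)
  tW≡r : r * 1/ W * W ≡ r
  tW≡r = begin
    r * 1/ W * W    ≡⟨ ℚP.*-assoc r (1/ W) W ⟩
    r * (1/ W * W)  ≡⟨ cong (r *_) (ℚP.*-inverseˡ W) ⟩
    r * 1ℚ          ≡⟨ ℚP.*-identityʳ r ⟩
    r               ∎
    where open ≡-Reasoning

≤ᵘ⇔cross-difference≤0 : ∀ {p q} → p ℚᵘ.≤ q ⇔ (↥ p ℤ.* ↧ q ℤ.- ↥ q ℤ.* ↧ p ℤ.≤ 0ℤ)
≤ᵘ⇔cross-difference≤0 = mk⇔ (λ p≤q → ℤP.i≤j⇒i-j≤0 (ℚᵘP.drop-*≤* p≤q))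
                              (λ d≤0 → ℚᵘ.*≤* (ℤP.i-j≤0⇒i≤j d≤0))

toℚᵘ-≤⇔≤ᵘ : ∀ {p q p′ q′} → toℚᵘ p ℚᵘ.≃ p′ → toℚᵘ q ℚᵘ.≃ q′ → p ≤ q ⇔ p′ ℚᵘ.≤ q′
toℚᵘ-≤⇔≤ᵘ p≃p′ q≃q′ = mk⇔
  (λ p≤q → ℚᵘP.≤-respʳ-≃ q≃q′ (ℚᵘP.≤-respˡ-≃ p≃p′ (ℚP.toℚᵘ-mono-≤ p≤q)))
  (λ p′≤q′ → ℚP.toℚᵘ-cancel-≤
    (ℚᵘP.≤-respʳ-≃ (ℚᵘP.≃-sym q≃q′) (ℚᵘP.≤-respˡ-≃ (ℚᵘP.≃-sym p≃p′) p′≤q′)))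

toℚᵘ-fromℚᵘ-* : ∀ p q → toℚᵘ (fromℚᵘ p * fromℚᵘ q) ℚᵘ.≃ p ℚᵘ.* q
toℚᵘ-fromℚᵘ-* p q = ℚᵘP.≃-trans (ℚP.toℚᵘ-homo-* (fromℚᵘ p) (fromℚᵘ q))
                                (ℚᵘP.*-cong (ℚP.toℚᵘ-fromℚᵘ p) (ℚP.toℚᵘ-fromℚᵘ q))

Q-as-cross-difference : ∀ (A₁ A₂ B C : ℤ) →
  ((A₁ ℤ.* A₁) ℤ.* C ℤ.+ (A₂ ℤ.* A₂) ℤ.* B) ℤ.* ℤ.1ℤ ℤ.- (A₁ ℤ.* A₂) ℤ.* (B ℤ.* C)
    ≡ (C ℤ.* A₁ ℤ.* A₁) ℤ.- (B ℤ.* C ℤ.* A₁ ℤ.* A₂) ℤ.+ (B ℤ.* A₂ ℤ.* A₂)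
Q-as-cross-difference = solve-∀

OAV-weights≤1 : ∀ {s t} → (s + t ℚ.< 1ℚ) ⊎ ((t ≡ 0ℚ) × (s ≤ 1ℚ)) → s + t ≤ 1ℚ
OAV-weights≤1     (inj₁ s+t<1)        = ℚP.<⇒≤ s+t<1
OAV-weights≤1 {s} (inj₂ (refl , s≤1)) = subst (_≤ 1ℚ) (sym (ℚP.+-identityʳ s)) s≤1

OVB-weights≤1 : ∀ {s t} → (s + t ℚ.< 1ℚ) ⊎ ((s ≡ 0ℚ) × (t ≤ 1ℚ)) → s + t ≤ 1ℚ
OVB-weights≤1         (inj₁ s+t<1)        = ℚP.<⇒≤ s+t<1
OVB-weights≤1 {t = t} (inj₂ (refl , t≤1)) = subst (_≤ 1ℚ) (sym (ℚP.+-identityˡ t)) t≤1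

module Region (b c a₁ a₂ : ℕ) .{{_ : NonZero b}} .{{_ : NonZero c}} where
  α β M : ℚ
  α = ℕ→ℚ a₁
  β = ℕ→ℚ a₂
  M = α * β

  ℓ : Point → ℚ
  ℓ = linear α β

  A V B : Point
  A = vA b c a₁ a₂
  V = vV b c a₁ a₂
  B = vB b c a₁ a₂

  0≤M : 0ℚ ≤ M
  0≤M = ℚP.nonNegative⁻¹ M {{ℚP.nonNeg*nonNeg⇒nonNeg α {{ℚP.normalize-nonNeg a₁ 1}}
                                                      β {{ℚP.normalize-nonNeg a₂ 1}}}}

  linear[A]≡M : ℓ A ≡ M
  linear[A]≡M = trans (cong (λ z → M + z) (ℚP.*-zeroʳ β)) (ℚP.+-identityʳ M)

  linear[B]≡M : ℓ B ≡ M
  linear[B]≡M = begin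
    α * 0ℚ + β * α  ≡⟨ cong (_+ β * α) (ℚP.*-zeroʳ α) ⟩
    0ℚ + β * α      ≡⟨ ℚP.+-identityˡ (β * α) ⟩
    β * α           ≡⟨ ℚP.*-comm β α ⟩
    M               ∎
    where open ≡-Reasoning

  linear[tV]≡t*linear[V] : ∀ t → ℓ (comb 0ℚ A t V) ≡ t * ℓ V
  linear[tV]≡t*linear[V] t = begin
    ℓ (comb 0ℚ A t V)       ≡⟨ linear-comb α β 0ℚ A t V ⟩
    0ℚ * ℓ A + t * ℓ V      ≡⟨ cong (_+ t * ℓ V) (ℚP.*-zeroˡ (ℓ A)) ⟩
    0ℚ + t * ℓ V            ≡⟨ ℚP.+-identityˡ (t * ℓ V) ⟩
    t * ℓ V                 ∎
    where open ≡-Reasoning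

  tV∈P : ∀ {t} → 0ℚ ≤ t → t ℚ.< 1ℚ → InP b c a₁ a₂ (comb 0ℚ A t V)
  tV∈P {t} 0≤t t<1 =
    inj₁ (0ℚ , t , ℚP.≤-refl , 0≤t , inj₁ (subst (ℚ._< 1ℚ) (sym (ℚP.+-identityˡ t)) t<1) , refl)

  linear≤M-on-P⇔linear[V]≤M : (∀ x → InP b c a₁ a₂ x → ℓ x ≤ M) ⇔ ℓ V ≤ M
  linear≤M-on-P⇔linear[V]≤M = mk⇔ V-below P-below
    where
    V-below : (∀ x → InP b c a₁ a₂ x → ℓ x ≤ M) → ℓ V ≤ M
    V-below ℓ≤M = ℚP.≮⇒≥ M≮ℓV
      where
      M≮ℓV : ¬ M ℚ.< ℓ V
      M≮ℓV M<ℓV =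
        let t , 0≤t , t<1 , M<tℓV = scale-above 0≤M M<ℓV
        in ℚP.<-irrefl refl (ℚP.<-≤-trans M<tℓV
             (subst (_≤ M) (linear[tV]≡t*linear[V] t) (ℓ≤M _ (tV∈P 0≤t t<1))))

    P-below : ℓ V ≤ M → ∀ x → InP b c a₁ a₂ x → ℓ x ≤ M
    P-below V≤M _ (inj₁ (s , t , 0≤s , 0≤t , weights , refl)) =
      subst (_≤ M) (sym (linear-comb α β s A t V))
        (convex-≤ 0≤s 0≤t (OAV-weights≤1 weights) (ℚP.≤-reflexive linear[A]≡M) V≤M 0≤M)
    P-below V≤M _ (inj₂ (s , t , 0≤s , 0≤t , weights , refl)) =
      subst (_≤ M) (sym (linear-comb α β s V t B))
        (convex-≤ 0≤s 0≤t (OVB-weights≤1 weights) V≤M (ℚP.≤-reflexive linear[B]≡M) 0≤M)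

module _ (b′ c′ a₁ a₂ : ℕ) where
  open Region (suc b′) (suc c′) a₁ a₂

  -- a₁/b is by definition fromℚᵘ (mkℚᵘ (+ a₁) b′), so toℚᵘ sends ℓ(V) and a₁a₂ to
  -- these; their denominators are 1 * b and 1 * c rather than b and c.
  Vᵘ Mᵘ : ℚᵘ
  Vᵘ = ℚᵘ.mkℚᵘ (+ a₁) 0 ℚᵘ.* ℚᵘ.mkℚᵘ (+ a₁) b′ ℚᵘ.+ ℚᵘ.mkℚᵘ (+ a₂) 0 ℚᵘ.* ℚᵘ.mkℚᵘ (+ a₂) c′
  Mᵘ = ℚᵘ.mkℚᵘ (+ a₁) 0 ℚᵘ.* ℚᵘ.mkℚᵘ (+ a₂) 0

  cross-difference≡Q : ↥ Vᵘ ℤ.* ↧ Mᵘ ℤ.- ↥ Mᵘ ℤ.* ↧ Vᵘ ≡ Q (suc b′) (suc c′) a₁ a₂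
  cross-difference≡Q = begin
    ↥ Vᵘ ℤ.* ↧ Mᵘ ℤ.- ↥ Mᵘ ℤ.* ↧ Vᵘ
      ≡⟨ cong (λ d → ↥ Vᵘ ℤ.* ↧ Mᵘ ℤ.- ↥ Mᵘ ℤ.* d) (ℤP.pos-* (1 ℕ.* suc b′) (1 ℕ.* suc c′)) ⟩
    _ ≡⟨ Q-as-cross-difference (+ a₁) (+ a₂) (+ (1 ℕ.* suc b′)) (+ (1 ℕ.* suc c′)) ⟩
    Q (1 ℕ.* suc b′) (1 ℕ.* suc c′) a₁ a₂
      ≡⟨ cong₂ (λ m n → Q m n a₁ a₂) (ℕP.*-identityˡ (suc b′)) (ℕP.*-identityˡ (suc c′)) ⟩
    Q (suc b′) (suc c′) a₁ a₂ ∎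
    where open ≡-Reasoning

  linear[V]≤M⇔Q≤0 : ℓ V ≤ M ⇔ (Q (suc b′) (suc c′) a₁ a₂ ℤ.≤ 0ℤ)
  linear[V]≤M⇔Q≤0 = ⇔-trans (toℚᵘ-≤⇔≤ᵘ toℚᵘ-V toℚᵘ-M)
    (subst (λ d → Vᵘ ℚᵘ.≤ Mᵘ ⇔ (d ℤ.≤ 0ℤ)) cross-difference≡Q ≤ᵘ⇔cross-difference≤0)
    where
    toℚᵘ-V : toℚᵘ (ℓ V) ℚᵘ.≃ Vᵘ
    toℚᵘ-V = ℚᵘP.≃-trans (ℚP.toℚᵘ-homo-+ (α * (+ a₁ ℚ./ suc b′)) (β * (+ a₂ ℚ./ suc c′)))
      (ℚᵘP.+-cong (toℚᵘ-fromℚᵘ-* (ℚᵘ.mkℚᵘ (+ a₁) 0) (ℚᵘ.mkℚᵘ (+ a₁) b′))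
                  (toℚᵘ-fromℚᵘ-* (ℚᵘ.mkℚᵘ (+ a₂) 0) (ℚᵘ.mkℚᵘ (+ a₂) c′)))
    toℚᵘ-M : toℚᵘ M ℚᵘ.≃ Mᵘ
    toℚᵘ-M = toℚᵘ-fromℚᵘ-* (ℚᵘ.mkℚᵘ (+ a₁) 0) (ℚᵘ.mkℚᵘ (+ a₂) 0)

lemma3p2 : (b c : ℕ) .{{_ : NonZero b}} .{{_ : NonZero c}} (a₁ a₂ : ℕ) →
    0 < a₁ → 0 < a₂ →
    PosImagRoot b c a₁ a₂ ⇔
      (∀ (p q : ℚ) → InP b c a₁ a₂ (p , q) →
        ℕ→ℚ a₁ * p + ℕ→ℚ a₂ * q ≤ ℕ→ℚ a₁ * ℕ→ℚ a₂)
lemma3p2 (suc b′) (suc c′) a₁ a₂ 0<a₁ 0<a₂ = mk⇔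
  (λ (_ , _ , Q≤0) p q → from P⇔V (from V⇔Q Q≤0) (p , q))
  (λ P-below → 0<a₁ , 0<a₂ , to V⇔Q (to P⇔V (λ (p , q) → P-below p q)))
  where
  open Equivalence
  P⇔V = Region.linear≤M-on-P⇔linear[V]≤M (suc b′) (suc c′) a₁ a₂
  V⇔Q = linear[V]≤M⇔Q≤0 b′ c′ a₁ a₂
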